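{- Let $\Gamma$ be a digraph, $F$ any maximum out forest of $\Gamma$, and $i,j$ vertices with $(i,j)\in E(\Gamma)$. Then $F$ does not contain the arc $(i,j)$ if and only if $F$ contains an arc $(k,j)$ for some $k\neq i$ or $i$ is reachable from $j$ in $F$.
   Context: $\Gamma$ is a finite loopless digraph. $w$ is reachable from $z$ if $w=z$ or there is a directed path from $z$ to $w$. A diverging forest is a digraph without circuits in which every vertex has indegree at most 1. A maximum out forest is a spanning subgraph of $\Gamma$ which is a diverging forest with the maximum possible number of arcs. -}

module Defs where

open import Data.Nat using (ℕ; _≤_)
open import Data.Bool using (Bool; true; false; T)
open import Data.Fin using (Fin)
open import Data.List using (List; length; filter; allFin; cartesianProduct)
open import Data.Product using (_×_; _,_; proj₁; proj₂)
open import Relation.Nullary using (¬_)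
open import Relation.Binary.PropositionalEquality using (_≡_)
open import Relation.Binary.Construct.Closure.Transitive using (TransClosure)
open import Relation.Binary.Construct.Closure.ReflexiveTransitive using (Star)
open import Data.Bool using (_≟_)
open import Relation.Nullary.Decidable using (Dec)

record Digraph (n : ℕ) : Set where
  field
    arc      : Fin n → Fin n → Bool
    loopless : ∀ i → arc i i ≡ false
open Digraph public

_∋_⟶_ : ∀ {n} → (Fin n → Fin n → Bool) → Fin n → Fin n → Set
A ∋ i ⟶ j = T (A i j)

SpanningSubgraph : ∀ {n} → Digraph n → (Fin n → Fin n → Bool) → Set
SpanningSubgraph G F = ∀ i j → F ∋ i ⟶ j → arc G ∋ i ⟶ j

arcCount : ∀ {n} → (Fin n → Fin n → Bool) → ℕ
arcCount {n} F =
  length (filter (λ p → F (proj₁ p) (proj₂ p) ≟ true)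
                 (cartesianProduct (allFin n) (allFin n)))

Reachable : ∀ {n} → (Fin n → Fin n → Bool) → Fin n → Fin n → Set
Reachable F z w = Star (λ a b → F ∋ a ⟶ b) z w

-- no circuits: no vertex lies on a closed directed walk of positive length
-- (a closed walk of positive length contains a circuit, and conversely)
Acyclic : ∀ {n} → (Fin n → Fin n → Bool) → Set
Acyclic F = ∀ v → ¬ TransClosure (λ a b → F ∋ a ⟶ b) v v

InDegreeAtMostOne : ∀ {n} → (Fin n → Fin n → Bool) → Set
InDegreeAtMostOne F = ∀ i k j → F ∋ i ⟶ j → F ∋ k ⟶ j → i ≡ k

DivergingForest : ∀ {n} → (Fin n → Fin n → Bool) → Set
DivergingForest F = Acyclic F × InDegreeAtMostOne F

OutForest : ∀ {n} → Digraph n → (Fin n → Fin n → Bool) → Set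
OutForest G F = SpanningSubgraph G F × DivergingForest F

MaximumOutForest : ∀ {n} → Digraph n → (Fin n → Fin n → Bool) → Set
MaximumOutForest G F =
  OutForest G F × (∀ F′ → OutForest G F′ → arcCount F′ ≤ arcCount F)

module Submission where

-- If (i, j) ∉ F, no other arc of F enters j and i is not reachable from j, then F + (i, j)
-- is still an out forest: j gets indegree 1, and a circuit through the new arc would
-- continue into a path from j back to i in F. As it has one arc more than F, this
-- contradicts maximality. Conversely, another arc into j or a path from j to i forbids
-- (i, j) ∈ F. The case split is constructive because reachability is decidable in an
-- acyclic digraph on n vertices, where every walk has fewer than n arcs.

open import Defs
open import Level using (0ℓ)
open import Data.Nat as ℕ using (ℕ; zero; suc; s≤s)
open import Data.Nat.Properties using (<⇒≱; ≮⇒≥; m<n⇒m<1+n)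
open import Data.Fin as Fin using (Fin; toℕ; fromℕ<)
open import Data.Fin.Properties using (any?; pigeonhole; toℕ-fromℕ<)
open import Data.Bool as Bool using (Bool; true; _∧_; _∨_)
open import Data.Bool.Properties using (T?; T-≡; T-∧; T-∨)
open import Data.List using (_∷_; length; filter)
open import Data.List.Membership.Propositional using (_∈_)
open import Data.List.Membership.Propositional.Properties using (∈-cartesianProduct⁺; ∈-allFin)
open import Data.List.Relation.Unary.Any using (here; there)
open import Data.List.Relation.Binary.Sublist.Propositional using (⊆-refl)
open import Data.List.Relation.Binary.Sublist.Heterogeneous.Properties using (⊆-filter-Sublist; length-mono-≤)
open import Data.Product as Product using (∃; ∃-syntax; _×_; _,_; proj₁; proj₂)
open import Data.Sum as Sum using (_⊎_; inj₁; inj₂)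
open import Function using (_∘_)
open import Function.Bundles using (_⇔_; mk⇔; Equivalence)
open import Relation.Nullary using (¬_; yes; no; ¬?; contradiction)
open import Relation.Nullary.Decidable using (⌊_⌋; _×-dec_; toWitness; fromWitness; decidable-stable)
import Relation.Unary as U
open import Relation.Binary using (Rel; Decidable)
open import Relation.Binary.PropositionalEquality using (_≡_; _≢_; refl; subst; sym)
open import Relation.Binary.Construct.Closure.Transitive using (TransClosure; [_]; _∷_)
open import Relation.Binary.Construct.Closure.ReflexiveTransitive using (Star; ε; _◅_; _◅◅_)

module _ {A : Set} {_∼_ : Rel A 0ℓ} where

  _◅⁺_ : ∀ {x y z} → x ∼ y → Star _∼_ y z → TransClosure _∼_ x z
  x∼y ◅⁺ ε = [ x∼y ]
  x∼y ◅⁺ (y∼z ◅ z∼⋆w) = x∼y ∷ (y∼z ◅⁺ z∼⋆w)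

  ⁺⇒⋆ : ∀ {x y} → TransClosure _∼_ x y → Star _∼_ x y
  ⁺⇒⋆ [ x∼y ] = x∼y ◅ ε
  ⁺⇒⋆ (x∼y ∷ y∼⁺z) = x∼y ◅ ⁺⇒⋆ y∼⁺z

module Walks {n : ℕ} (_∼_ : Rel (Fin n) 0ℓ) where

  data Walk : ℕ → Rel (Fin n) 0ℓ where
    []  : ∀ {a} → Walk 0 a a
    _∷_ : ∀ {m a b c} → a ∼ b → Walk m b c → Walk (suc m) a c

  walk? : Decidable _∼_ → ∀ m → Decidable (Walk m)
  walk? _∼?_ zero a c with a Fin.≟ c
  ... | yes refl = yes []
  ... | no a≢c = no λ { [] → a≢c refl }
  walk? _∼?_ (suc m) a c with any? (λ b → (a ∼? b) ×-dec walk? _∼?_ m b c)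
  ... | yes (_ , a∼b , w) = yes (a∼b ∷ w)
  ... | no ∄b = no λ { (a∼b ∷ w) → ∄b (_ , a∼b , w) }

  walk⇒⋆ : ∀ {m a c} → Walk m a c → Star _∼_ a c
  walk⇒⋆ [] = ε
  walk⇒⋆ (a∼b ∷ w) = a∼b ◅ walk⇒⋆ w

  ⋆⇒walk : ∀ {a c} → Star _∼_ a c → ∃ λ m → Walk m a c
  ⋆⇒walk ε = 0 , []
  ⋆⇒walk (a∼b ◅ b∼⋆c) = Product.map suc (a∼b ∷_) (⋆⇒walk b∼⋆c)

  vertex : ∀ {m a c} → Walk m a c → Fin (suc m) → Fin n
  vertex {a = a} _ Fin.zero = a
  vertex [] (Fin.suc ())
  vertex (_ ∷ w) (Fin.suc p) = vertex w p

  vertex-⋆ : ∀ {m a c} (w : Walk m a c) p → Star _∼_ a (vertex w p)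
  vertex-⋆ _ Fin.zero = ε
  vertex-⋆ (a∼b ∷ w) (Fin.suc p) = a∼b ◅ vertex-⋆ w p

  vertex-⁺ : ∀ {m a c} (w : Walk m a c) {p q} → p Fin.< q →
             TransClosure _∼_ (vertex w p) (vertex w q)
  vertex-⁺ (a∼b ∷ w) {Fin.zero} {Fin.suc q} _ = a∼b ◅⁺ vertex-⋆ w q
  vertex-⁺ (_ ∷ w) {Fin.suc p} {Fin.suc q} (s≤s p<q) = vertex-⁺ w p<q

  module _ (acyclic : ∀ v → ¬ TransClosure _∼_ v v) where

    -- A walk with m ≥ n arcs visits m + 1 > n vertices, so one repeats and closes a circuit.
    walk-length< : ∀ {m a c} → Walk m a c → m ℕ.< n
    walk-length< {m} w = decidable-stable (m ℕ.<? n) λ m≮n →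
      let p , q , p<q , vp≡vq = pigeonhole (s≤s (≮⇒≥ m≮n)) (vertex w)
      in acyclic _ (subst (λ v → TransClosure _∼_ v (vertex w q)) vp≡vq (vertex-⁺ w p<q))

    reachable? : Decidable _∼_ → Decidable (Star _∼_)
    reachable? _∼?_ a c with any? (λ (m : Fin n) → walk? _∼?_ (toℕ m) a c)
    ... | yes (_ , w) = yes (walk⇒⋆ w)
    ... | no ∄w = no λ a∼⋆c →
      let m , w = ⋆⇒walk a∼⋆c
          m<n = walk-length< w
      in ∄w (fromℕ< m<n , subst (λ k → Walk k a c) (sym (toℕ-fromℕ< m<n)) w)

module _ {A : Set} {P Q : U.Pred A 0ℓ} (P? : U.Decidable P) (Q? : U.Decidable Q)
         (P⇒Q : ∀ {x} → P x → Q x) where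

  length-filter-mono : ∀ xs → length (filter P? xs) ℕ.≤ length (filter Q? xs)
  length-filter-mono xs = length-mono-≤ (⊆-filter-Sublist P? Q? (λ { refl → P⇒Q }) (⊆-refl {x = xs}))

  length-filter-< : ∀ {x xs} → x ∈ xs → Q x → ¬ P x → length (filter P? xs) ℕ.< length (filter Q? xs)
  length-filter-< {xs = y ∷ ys} x∈xs qx ¬px with P? y | Q? y | x∈xs
  ... | yes py | no ¬qy | _ = contradiction (P⇒Q py) ¬qy
  ... | yes px | yes _ | here refl = contradiction px ¬px
  ... | yes _ | yes _ | there x∈ys = s≤s (length-filter-< x∈ys qx ¬px)
  ... | no _ | yes _ | here refl = s≤s (length-filter-mono ys)
  ... | no _ | yes _ | there x∈ys = m<n⇒m<1+n (length-filter-< x∈ys qx ¬px)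
  ... | no _ | no ¬qy | here refl = contradiction qx ¬qy
  ... | no _ | no _ | there x∈ys = length-filter-< x∈ys qx ¬px

arcCount-< : ∀ {n} {F F′ : Fin n → Fin n → Bool} {i j : Fin n} →
             (∀ {a b} → F ∋ a ⟶ b → F′ ∋ a ⟶ b) → F′ ∋ i ⟶ j → ¬ F ∋ i ⟶ j →
             arcCount F ℕ.< arcCount F′
arcCount-< {F = F} {F′} {i} {j} F⊆F′ F′ij ¬Fij =
  length-filter-< (λ p → F (proj₁ p) (proj₂ p) Bool.≟ true)
                  (λ p → F′ (proj₁ p) (proj₂ p) Bool.≟ true)
                  (Equivalence.to T-≡ ∘ F⊆F′ ∘ Equivalence.from T-≡)
                  (∈-cartesianProduct⁺ (∈-allFin i) (∈-allFin j))
                  (Equivalence.to T-≡ F′ij)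
                  (¬Fij ∘ Equivalence.from T-≡)

module _ {A : Set} {_∼_ _∼′_ : Rel A 0ℓ} {i j : A}
         (split : ∀ {x y} → x ∼′ y → x ∼ y ⊎ (x ≡ i × y ≡ j)) where

  ⁺-split : ∀ {x y} → TransClosure _∼′_ x y →
            TransClosure _∼_ x y ⊎ (Star _∼_ x i × Star _∼_ j y)
  ⁺-split [ x∼′y ] with split x∼′y
  ... | inj₁ x∼y = inj₁ [ x∼y ]
  ... | inj₂ (refl , refl) = inj₂ (ε , ε)
  ⁺-split (x∼′y ∷ y∼′⁺z) with split x∼′y | ⁺-split y∼′⁺z
  ... | inj₁ x∼y | inj₁ y∼⁺z = inj₁ (x∼y ∷ y∼⁺z)
  ... | inj₁ x∼y | inj₂ (y∼⋆i , j∼⋆z) = inj₂ (x∼y ◅ y∼⋆i , j∼⋆z)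
  ... | inj₂ (refl , refl) | inj₁ j∼⁺z = inj₂ (ε , ⁺⇒⋆ j∼⁺z)
  ... | inj₂ (refl , refl) | inj₂ (_ , j∼⋆z) = inj₂ (ε , j∼⋆z)

  acyclic-split : (∀ v → ¬ TransClosure _∼_ v v) → ¬ Star _∼_ j i →
                  ∀ v → ¬ TransClosure _∼′_ v v
  acyclic-split acyclic ¬j∼⋆i v v∼′⁺v with ⁺-split v∼′⁺v
  ... | inj₁ v∼⁺v = acyclic v v∼⁺v
  ... | inj₂ (v∼⋆i , j∼⋆v) = ¬j∼⋆i (j∼⋆v ◅◅ v∼⋆i)

insertArc : ∀ {n} → (Fin n → Fin n → Bool) → Fin n → Fin n → Fin n → Fin n → Bool
insertArc F i j a b = F a b ∨ (⌊ a Fin.≟ i ⌋ ∧ ⌊ b Fin.≟ j ⌋)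

module InsertArc {n} (F : Fin n → Fin n → Bool) (i j : Fin n) where

  insertArc⁻ : ∀ {a b} → insertArc F i j ∋ a ⟶ b → F ∋ a ⟶ b ⊎ (a ≡ i × b ≡ j)
  insertArc⁻ {a} {b} =
    Sum.map₂ (Product.map (toWitness {a? = a Fin.≟ i}) (toWitness {a? = b Fin.≟ j}) ∘ Equivalence.to T-∧)
    ∘ Equivalence.to (T-∨ {F a b})

  insertArc⁺ : ∀ {a b} → F ∋ a ⟶ b → insertArc F i j ∋ a ⟶ b
  insertArc⁺ {a} {b} = Equivalence.from (T-∨ {F a b}) ∘ inj₁

  insertArc-new : insertArc F i j ∋ i ⟶ j
  insertArc-new =
    Equivalence.from (T-∨ {F i j}) (inj₂ (Equivalence.from T-∧
      (fromWitness {a? = i Fin.≟ i} refl , fromWitness {a? = j Fin.≟ j} refl)))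

  insertArc-outForest : ∀ {G : Digraph n} → OutForest G F → arc G ∋ i ⟶ j →
                        (∀ k → ¬ F ∋ k ⟶ j) → ¬ Reachable F j i →
                        OutForest G (insertArc F i j)
  insertArc-outForest {G} (spanning , acyclic , inDegree≤1) Gij j-root ¬j↝i =
    spanning′ , acyclic-split insertArc⁻ acyclic ¬j↝i , inDegree≤1′
    where
    spanning′ : SpanningSubgraph G (insertArc F i j)
    spanning′ a b F′ab with insertArc⁻ F′ab
    ... | inj₁ Fab = spanning a b Fab
    ... | inj₂ (refl , refl) = Gij

    inDegree≤1′ : InDegreeAtMostOne (insertArc F i j)
    inDegree≤1′ a c b F′ab F′cb with insertArc⁻ F′ab | insertArc⁻ F′cb
    ... | inj₁ Fab | inj₁ Fcb = inDegree≤1 a c b Fab Fcb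
    ... | inj₁ Fab | inj₂ (_ , refl) = contradiction Fab (j-root a)
    ... | inj₂ (_ , refl) | inj₁ Fcb = contradiction Fcb (j-root c)
    ... | inj₂ (refl , _) | inj₂ (refl , _) = refl

lemma5 : ∀ {n} (G : Digraph n) (F : Fin n → Fin n → Bool) → MaximumOutForest G F →
         ∀ (i j : Fin n) → arc G ∋ i ⟶ j →
         (¬ (F ∋ i ⟶ j)) ⇔ ((∃[ k ] (k ≢ i × F ∋ k ⟶ j)) ⊎ Reachable F j i)
lemma5 G F (forest@(_ , acyclic , inDegree≤1) , maximum) i j Gij = mk⇔ to from
  where
  open Walks (λ a b → F ∋ a ⟶ b)
  open InsertArc F i j

  from : (∃[ k ] (k ≢ i × F ∋ k ⟶ j)) ⊎ Reachable F j i → ¬ F ∋ i ⟶ j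
  from (inj₁ (k , k≢i , Fkj)) Fij = k≢i (inDegree≤1 k i j Fkj Fij)
  from (inj₂ j↝i) Fij = acyclic i (Fij ◅⁺ j↝i)

  to : ¬ F ∋ i ⟶ j → (∃[ k ] (k ≢ i × F ∋ k ⟶ j)) ⊎ Reachable F j i
  to ¬Fij with any? (λ k → ¬? (k Fin.≟ i) ×-dec T? (F k j))
             | reachable? acyclic (λ a b → T? (F a b)) j i
  ... | yes otherParent | _ = inj₁ otherParent
  ... | no _ | yes j↝i = inj₂ j↝i
  ... | no ∄otherParent | no ¬j↝i =
    contradiction (maximum (insertArc F i j) (insertArc-outForest {G} forest Gij j-root ¬j↝i))
                  (<⇒≱ more-arcs)
    where
    more-arcs : arcCount F ℕ.< arcCount (insertArc F i j)
    more-arcs = arcCount-< {i = i} {j} insertArc⁺ insertArc-new ¬Fij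

    j-root : ∀ k → ¬ F ∋ k ⟶ j
    j-root k Fkj with k Fin.≟ i
    ... | yes refl = ¬Fij Fkj
    ... | no k≢i = ∄otherParent (k , k≢i , Fkj)
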